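{- Let $d\ge1$ and let $A=(a_{i,k})_{0\le i,k\le d-1}\in\mathbb{Z}^{d\times d}$ be a reduced idealizing matrix. Then the number of $\beta\in\mathbb{Z}^d$ such that $$\tilde A:=\begin{pmatrix}A&\beta\\0&1\end{pmatrix}\in\mathbb{Z}^{(d+1)\times(d+1)}$$ is a reduced idealizing matrix is $a_{d-1,d-1}^{\,d}$.
   Context: Rows and columns of an $m\times m$ matrix are indexed $0,\dots,m-1$. An idealizing matrix is an integral upper triangular matrix $A=(a_{i,k})\in\mathbb{Z}^{m\times m}$ of full rank such that for each $0\le j\le m-2$, the $j$-th column shifted down by one position (i.e. the vector whose entry in row $i+1$ is $a_{i,j}$ for $0\le i\le m-2$ and whose entry in row $0$ is $0$) lies in the $\mathbb{Z}$-span of the columns $0,1,\dots,j+1$ of $A$. (Such matrices are exactly those whose column span is the image, under the coefficient map $\sum_{n<m} c_nX^n\mapsto (c_0,\dots,c_{m-1})$, of a finite-index ideal of $\mathbb{Z}[X]/(f)$ for some monic $f$ of degree $m$, with the $j$-th column corresponding to a generator of degree $j$.) An idealizing matrix is reduced if its diagonal entries are positive and, in every row $i$, each off-diagonal entry $a_{i,k}$ ($k>i$) satisfies $0\le a_{i,k}\le a_{i,i}-1$. -}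

module Defs where

open import Data.Nat using (ℕ; zero; suc)
import Data.Nat as N
open import Data.Integer using (ℤ; +_; _+_; _*_; _-_; _≤_; _<_; 0ℤ; 1ℤ)
open import Data.Fin using (Fin; zero; suc; toℕ; inject₁)
open import Data.Maybe using (Maybe; just; nothing)
import Data.Maybe as M
open import Data.Product using (Σ; _×_)
open import Relation.Binary.PropositionalEquality using (_≡_)

-- An m×m integer matrix, a(i,k) = A i k (row i, column k), indices 0..m-1.
Matrix : ℕ → Set
Matrix m = Fin m → Fin m → ℤ

sumFin : ∀ {m} → (Fin m → ℤ) → ℤ
sumFin {zero}  f = 0ℤ
sumFin {suc m} f = f zero + sumFin (λ i → f (suc i))

col : ∀ {m} → Matrix m → Fin m → Fin m → ℤ
col A k i = A i k

combo : ∀ {m} → Matrix m → (Fin m → ℤ) → Fin m → ℤ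
combo A c i = sumFin (λ k → c k * A i k)

shiftDown : ∀ {m} → (Fin m → ℤ) → Fin m → ℤ
shiftDown v zero    = 0ℤ
shiftDown v (suc i) = v (inject₁ i)

UpperTriangular : ∀ {m} → Matrix m → Set
UpperTriangular A = ∀ i k → toℕ k N.< toℕ i → A i k ≡ 0ℤ

-- Full rank: the columns are linearly independent (over ℤ, equivalently over ℚ).
FullRank : ∀ {m} → Matrix m → Set
FullRank {m} A = ∀ (c : Fin m → ℤ) → (∀ i → combo A c i ≡ 0ℤ) → ∀ k → c k ≡ 0ℤ

InSpanUpTo : ∀ {m} → Matrix m → ℕ → (Fin m → ℤ) → Set
InSpanUpTo {m} A n v =
  Σ (Fin m → ℤ) λ c → (∀ k → n N.< toℕ k → c k ≡ 0ℤ) × (∀ i → v i ≡ combo A c i)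

IsIdealizing : ∀ {m} → Matrix m → Set
IsIdealizing {m} A =
  UpperTriangular A × FullRank A ×
  (∀ (j : Fin m) → suc (suc (toℕ j)) N.≤ m → InSpanUpTo A (suc (toℕ j)) (shiftDown (col A j)))

IsReduced : ∀ {m} → Matrix m → Set
IsReduced A =
  (∀ i → 0ℤ < A i i) ×
  (∀ i k → toℕ i N.< toℕ k → (0ℤ ≤ A i k) × (A i k ≤ A i i - 1ℤ))

IsReducedIdealizing : ∀ {m} → Matrix m → Set
IsReducedIdealizing A = IsIdealizing A × IsReduced A

-- For i : Fin (suc d): just i' if i = inject₁ i' (i < d), nothing if i = d (last).
inner : ∀ {d} → Fin (suc d) → Maybe (Fin d)
inner {zero}  zero    = nothing
inner {suc d} zero    = just zero
inner {suc d} (suc i) = M.map suc (inner i)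

extend : ∀ {d} → Matrix d → (Fin d → ℤ) → Matrix (suc d)
extend A β i k with inner i | inner k
... | just i' | just k' = A i' k'
... | just i' | nothing = β i'
... | nothing | just _  = 0ℤ
... | nothing | nothing = 1ℤ

module Submission where

-- For Ã = ( A β ; 0 1 ), everything required of Ã is inherited from A except
-- (i) the box condition 0 ≤ βᵢ < aᵢᵢ and (ii) the shift condition of column
-- d-1, which reads s = A·c + a·β for some c (s the last column of A shifted
-- down, a its last diagonal entry).  The shift conditions make each diagonal
-- entry a_{j,j} divide columns 0,…,j, so A = a·Q and s = a·T; then (ii) says
-- β ≡ T modulo the lattice Qℤᵈ and (i) puts β in the box ∏ [0, a·qᵢᵢ).  For
-- upper triangular Q such a translate meets the box in exactly aᵈ points:
-- solving from the last row upwards, each row leaves a choices.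

open import Defs
open import Data.Nat using (ℕ; suc)
open import Data.Integer using (ℤ; +_; _^_)
open import Data.Fin using (fromℕ)
open import Data.Vec using (Vec; lookup)
open import Data.List using (List; length)
open import Data.List.Membership.Propositional using (_∈_)
open import Data.List.Relation.Unary.Unique.Propositional using (Unique)
open import Data.Product using (Σ; _×_)
open import Function.Bundles using (_⇔_)
open import Relation.Binary.PropositionalEquality using (_≡_)

open import Data.Nat as ℕ using (zero; _≤_)
import Data.Nat.Properties as ℕ
open import Data.Integer as ℤ using (_+_; _*_; _-_; -[1+_]; 0ℤ; 1ℤ)
import Data.Integer.Properties as ℤ
open import Data.Integer.DivMod using (_/ℕ_; _%ℕ_; a≡a%ℕn+[a/ℕn]*n; n%ℕd<d)
open import Data.Integer.Divisibility.Signed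
open import Data.Integer.Tactic.RingSolver using (solve-∀)
open import Data.Fin using (Fin; zero; suc; toℕ; inject₁)
import Data.Fin.Properties as Fin
open import Data.Fin.Induction using (<-weakInduction)
open import Data.Fin.Relation.Unary.Top using (view; ‵fromℕ; ‵inject₁)
open import Data.Vec using ([]; _∷_; tabulate)
open import Data.Vec.Properties using (lookup∘tabulate; ∷-injectiveˡ; ∷-injectiveʳ)
open import Data.List using ([]; _∷_; _++_; map; upTo; concatMap)
open import Data.List.Properties using (length-map; length-upTo; length-++)
open import Data.List.Membership.Propositional using (find; lose)
open import Data.List.Membership.Propositional.Properties
  using (∈-map⁺; ∈-map⁻; ∈-upTo⁺; ∈-upTo⁻; ∈-concatMap⁺; ∈-concatMap⁻)
import Data.List.Relation.Unary.All as All
import Data.List.Relation.Unary.All.Properties as All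
open import Data.List.Relation.Unary.Any using (here)
open import Data.List.Relation.Unary.AllPairs as AllPairs using (AllPairs)
import Data.List.Relation.Unary.AllPairs.Properties as AllPairs
open import Data.List.Relation.Unary.Unique.Propositional.Properties using (upTo⁺)
open import Data.Maybe using (just; nothing; maybe)
open import Data.Product using (_,_; proj₁; proj₂)
open import Data.Sum using (_⊎_; inj₁; inj₂)
open import Data.Empty using (⊥-elim)
open import Function using (_∘_)
open import Function.Bundles using (mk⇔; Equivalence)
open import Relation.Binary.Definitions using (tri<; tri≈; tri>)
open import Relation.Binary.PropositionalEquality
  using (refl; sym; trans; cong; cong₂; subst; subst₂; _≢_; module ≡-Reasoning)

sumFin-cong : ∀ {m} {f g : Fin m → ℤ} → (∀ i → f i ≡ g i) → sumFin f ≡ sumFin g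
sumFin-cong {zero}  f≡g = refl
sumFin-cong {suc m} f≡g = cong₂ _+_ (f≡g zero) (sumFin-cong (f≡g ∘ suc))

sumFin-zero : ∀ {m} (f : Fin m → ℤ) → (∀ i → f i ≡ 0ℤ) → sumFin f ≡ 0ℤ
sumFin-zero {zero}  f f≡0 = refl
sumFin-zero {suc m} f f≡0 = cong₂ _+_ (f≡0 zero) (sumFin-zero (f ∘ suc) (f≡0 ∘ suc))

sumFin-last : ∀ {m} (f : Fin (suc m) → ℤ) → sumFin f ≡ sumFin (f ∘ inject₁) + f (fromℕ m)
sumFin-last {zero}  f = trans (ℤ.+-identityʳ (f zero)) (sym (ℤ.+-identityˡ (f zero)))
sumFin-last {suc m} f =
  trans (cong (_+_ (f zero)) (sumFin-last (f ∘ suc))) (sym (ℤ.+-assoc (f zero) _ _))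

sumFin-scale : ∀ {m} (a : ℤ) (f : Fin m → ℤ) → sumFin (λ i → a * f i) ≡ a * sumFin f
sumFin-scale {zero}  a f = sym (ℤ.*-zeroʳ a)
sumFin-scale {suc m} a f =
  trans (cong (_+_ (a * f zero)) (sumFin-scale a (f ∘ suc))) (sym (ℤ.*-distribˡ-+ a (f zero) _))

sumFin-single : ∀ {m} (f : Fin m → ℤ) (p : Fin m) → (∀ l → l ≢ p → f l ≡ 0ℤ) → sumFin f ≡ f p
sumFin-single f zero    f≡0 =
  trans (cong (_+_ (f zero)) (sumFin-zero (f ∘ suc) (λ i → f≡0 (suc i) λ ()))) (ℤ.+-identityʳ (f zero))
sumFin-single f (suc p) f≡0 = trans
  (cong₂ _+_ (f≡0 zero λ ()) (sumFin-single (f ∘ suc) p (λ l l≢p → f≡0 (suc l) (l≢p ∘ Fin.suc-injective))))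
  (ℤ.+-identityˡ _)

∣0 : ∀ {k} → k ∣ 0ℤ
∣0 = divides 0ℤ refl

∣-sumFin : ∀ {m} {k} (f : Fin m → ℤ) → (∀ l → k ∣ f l) → k ∣ sumFin f
∣-sumFin {zero}  f k∣f = ∣0
∣-sumFin {suc m} f k∣f = ∣m∣n⇒∣m+n (k∣f zero) (∣-sumFin (f ∘ suc) (k∣f ∘ suc))

∣-summand : ∀ {m} {k} (f : Fin m → ℤ) (p : Fin m) →
            k ∣ sumFin f → (∀ l → l ≢ p → k ∣ f l) → k ∣ f p
∣-summand f zero    k∣Σ k∣f = ∣m+n∣n⇒∣m k∣Σ (∣-sumFin (f ∘ suc) (λ i → k∣f (suc i) λ ()))
∣-summand f (suc p) k∣Σ k∣f =
  ∣-summand (f ∘ suc) p (∣m+n∣m⇒∣n k∣Σ (k∣f zero λ ())) (λ l l≢p → k∣f (suc l) (l≢p ∘ Fin.suc-injective))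

ShiftClosed : ∀ {m} → Matrix m → Set
ShiftClosed {m} A =
  ∀ (j : Fin m) → suc (suc (toℕ j)) ≤ m → InSpanUpTo A (suc (toℕ j)) (shiftDown (col A j))

module DiagonalDivisibility {n} (A : Matrix (suc n)) (ut : UpperTriangular A)
  (nonzero : ∀ i → A i i ≢ 0ℤ) (closed : ShiftClosed A) where

  DividesColumnsUpTo : Fin (suc n) → Set
  DividesColumnsUpTo j = ∀ i l → toℕ l ≤ toℕ j → A j j ∣ A i l

  -- Column 0 is a₀₀ followed by zeros.
  base : DividesColumnsUpTo zero
  base i l l≤0 with Fin.toℕ-injective {i = l} {j = zero} (ℕ.n≤0⇒n≡0 l≤0)
  base zero    .zero l≤0 | refl = ∣-refl
  base (suc i) .zero l≤0 | refl = subst (A zero zero ∣_) (sym (ut (suc i) zero ℕ.z<s)) ∣0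

  -- Passing from column j = inject₁ j' to column j+1 = suc j' by the shift
  -- condition of column j:  (column j shifted down) = Σ_{l ≤ j+1} c_l · (column l).
  module Step (j' : Fin n) (IH : DividesColumnsUpTo (inject₁ j')) where
    j : Fin (suc n)
    j = inject₁ j'

    toℕ-j : toℕ j ≡ toℕ j'
    toℕ-j = Fin.toℕ-inject₁ j'

    span : InSpanUpTo A (suc (toℕ j)) (shiftDown (col A j))
    span = closed j (ℕ.s≤s (subst (ℕ._< n) (sym toℕ-j) (Fin.toℕ<n j')))

    c : Fin (suc n) → ℤ
    c = proj₁ span

    shift≡ : ∀ x → shiftDown (col A j) x ≡ combo A c x
    shift≡ = proj₂ (proj₂ span)

    classify : ∀ l → l ≢ suc j' → toℕ l ≤ toℕ j' ⊎ c l ≡ 0ℤ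
    classify l l≢ with ℕ.<-cmp (toℕ l) (suc (toℕ j'))
    ... | tri< l< _ _ = inj₁ (ℕ.≤-pred l<)
    ... | tri≈ _ l≡ _ = ⊥-elim (l≢ (Fin.toℕ-injective l≡))
    ... | tri> _ _ l> = inj₂ (proj₁ (proj₂ span) l (subst (λ t → suc t ℕ.< toℕ l) (sym toℕ-j) l>))

    -- Row j+1 of the shift condition: a_{j,j} = c_{j+1} · a_{j+1,j+1}.
    diagonal : A j j ≡ c (suc j') * A (suc j') (suc j')
    diagonal = trans (shift≡ (suc j')) (sumFin-single _ (suc j') vanish)
      where
      vanish : ∀ l → l ≢ suc j' → c l * A (suc j') l ≡ 0ℤ
      vanish l l≢ with classify l l≢
      ... | inj₁ l≤  = trans (cong (c l *_) (ut (suc j') l (ℕ.s≤s l≤))) (ℤ.*-zeroʳ (c l))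
      ... | inj₂ c≡0 = trans (cong (_* A (suc j') l) c≡0) (ℤ.*-zeroˡ (A (suc j') l))

    instance
      c-nonZero : ℤ.NonZero (c (suc j'))
      c-nonZero = ℤ.≢-nonZero {c (suc j')} λ c≡0 →
        nonzero j (trans diagonal (trans (cong (_* A (suc j') (suc j')) c≡0) (ℤ.*-zeroˡ (A (suc j') (suc j')))))

    -- Row i of the shift condition: all terms but c_{j+1} a_{i,j+1} are divisible
    -- by a_{j,j} = c_{j+1} a_{j+1,j+1}; cancelling c_{j+1} gives column j+1.
    newColumn : ∀ i → A (suc j') (suc j') ∣ A i (suc j')
    newColumn i = *-cancelˡ-∣ (c (suc j')) (subst (_∣ c (suc j') * A i (suc j')) diagonal
                    (∣-summand _ (suc j') (subst (A j j ∣_) (shift≡ i) (shifted i)) others))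
      where
      shifted : ∀ x → A j j ∣ shiftDown (col A j) x
      shifted zero    = ∣0
      shifted (suc x) = IH (inject₁ x) j ℕ.≤-refl
      others : ∀ l → l ≢ suc j' → A j j ∣ c l * A i l
      others l l≢ with classify l l≢
      ... | inj₁ l≤  = ∣n⇒∣m*n (c l) (IH i l (subst (toℕ l ≤_) (sym toℕ-j) l≤))
      ... | inj₂ c≡0 = subst (λ t → A j j ∣ t * A i l) (sym c≡0) ∣0

    -- Old columns: a_{j+1,j+1} ∣ a_{j,j} ∣ a_{i,l}.
    next : DividesColumnsUpTo (suc j')
    next i l l≤ with ℕ.m≤n⇒m<n∨m≡n l≤
    ... | inj₁ l< = ∣-trans (divides (c (suc j')) diagonal) (IH i l (subst (toℕ l ≤_) (sym toℕ-j) (ℕ.≤-pred l<)))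
    ... | inj₂ l≡ with Fin.toℕ-injective {i = l} {j = suc j'} l≡
    ...   | refl = newColumn i

  lastDiagonal∣ : ∀ i k → A (fromℕ n) (fromℕ n) ∣ A i k
  lastDiagonal∣ i k = <-weakInduction DividesColumnsUpTo base Step.next (fromℕ n) i k
                        (subst (toℕ k ≤_) (sym (Fin.toℕ-fromℕ n)) (Fin.toℕ≤pred[n] k))

KeysDiffer : ∀ {U W : Set} → U × W → U × W → Set
KeysDiffer p q = proj₁ p ≢ proj₁ q

record Enumerates {U W : Set} (R : U → W → Set) (L : List (U × W)) : Set where
  field
    distinct : AllPairs KeysDiffer L
    sound    : ∀ {u w} → (u , w) ∈ L → R u w
    complete : ∀ {u w} → R u w → (u , w) ∈ L

open Enumerates

record Counting {U W : Set} (R : U → W → Set) (N : ℕ) : Set where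
  field
    list       : List (U × W)
    enumerates : Enumerates R list
    size       : length list ≡ N

open Counting

keys-unique : ∀ {U W : Set} {R : U → W → Set} {L} → Enumerates R L → Unique (map proj₁ L)
keys-unique E = AllPairs.map⁺ (distinct E)

keys-∈ : ∀ {U W : Set} {R : U → W → Set} {L} → Enumerates R L → ∀ u → (u ∈ map proj₁ L) ⇔ Σ W (R u)
keys-∈ {R = R} {L} E u = mk⇔ to (λ (w , Ruw) → ∈-map⁺ proj₁ (complete E Ruw))
  where
  to : u ∈ map proj₁ L → Σ _ (R u)
  to u∈ with ∈-map⁻ proj₁ u∈
  ... | (.u , w) , uw∈ , refl = w , sound E uw∈

counting-⇔ : ∀ {U W : Set} {R R' : U → W → Set} {N} → (∀ u w → R u w ⇔ R' u w) → Counting R N → Counting R' N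
counting-⇔ R⇔R' C = record
  { list       = list C
  ; enumerates = record
    { distinct = distinct (enumerates C)
    ; sound    = λ uw∈ → Equivalence.to (R⇔R' _ _) (sound (enumerates C) uw∈)
    ; complete = λ R'uw → complete (enumerates C) (Equivalence.from (R⇔R' _ _) R'uw)
    }
  ; size       = size C
  }

Residue : ℕ → ℤ → ℤ → ℤ → ℤ → Set
Residue a B r x y = (0ℤ ℤ.≤ x × x ℤ.< + a * B) × r ≡ y * B + x

quotient-nonneg : ∀ {m ρ B} J → + m ≡ + ρ + J * + B → ρ ℕ.< B → Σ ℕ λ j → J ≡ + j
quotient-nonneg (+ j)     _ _   = j , refl
quotient-nonneg {m} {ρ} {B} -[1+ t ] m≡ ρ<B =
  ⊥-elim (ℕ.<⇒≱ ρ<B (ℕ.≤-trans (ℕ.m≤m+n B (t ℕ.* B))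
                                 (ℕ.≤-trans (ℕ.m≤n+m _ m) (ℕ.≤-reflexive m+sB≡ρ))))
  where
  cancel : ∀ ρ s B → ρ + (ℤ.- s) * B + s * B ≡ ρ
  cancel = solve-∀
  m+sB≡ρ : m ℕ.+ suc t ℕ.* B ≡ ρ
  m+sB≡ρ = ℤ.+-injective (begin
    + (m ℕ.+ suc t ℕ.* B)                ≡⟨ trans (ℤ.pos-+ m _) (cong (_+_ (+ m)) (ℤ.pos-* (suc t) B)) ⟩
    + m + + suc t * + B                  ≡⟨ cong (_+ + suc t * + B) m≡ ⟩
    + ρ + -[1+ t ] * + B + + suc t * + B ≡⟨ cancel (+ ρ) (+ suc t) (+ B) ⟩
    + ρ                                  ∎)
    where open ≡-Reasoning

residue-offset : ∀ r ρ q y B x → r ≡ ρ + q * B → r ≡ y * B + x → x ≡ ρ + (q - y) * B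
residue-offset r ρ q y B x refl r≡ = begin
  x                     ≡⟨ ring₁ x (y * B) ⟩
  (y * B + x) - y * B   ≡⟨ cong (_- y * B) (sym r≡) ⟩
  (ρ + q * B) - y * B   ≡⟨ ring₂ ρ q y B ⟩
  ρ + (q - y) * B       ∎
  where
  open ≡-Reasoning
  ring₁ : ∀ x z → x ≡ (z + x) - z
  ring₁ = solve-∀
  ring₂ : ∀ ρ q y B → (ρ + q * B) - y * B ≡ ρ + (q - y) * B
  ring₂ = solve-∀

-- For B = b+1 > 0 write r = ρ + q·B with 0 ≤ ρ < B.  The residues of r modulo
-- B in [0, a·B) are ρ + j·B with quotient q - j, for j < a.
module Residues (a b : ℕ) (r : ℤ) where
  B : ℕ
  B = suc b

  ρ : ℕ
  ρ = r %ℕ B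

  q : ℤ
  q = r /ℕ B

  r≡ : r ≡ + ρ + q * + B
  r≡ = a≡a%ℕn+[a/ℕn]*n r B

  rep : ℕ → ℤ × ℤ
  rep j = + (ρ ℕ.+ j ℕ.* B) , q - + j

  rep-split : ∀ j → + (ρ ℕ.+ j ℕ.* B) ≡ + ρ + + j * + B
  rep-split j = trans (ℤ.pos-+ ρ (j ℕ.* B)) (cong (_+_ (+ ρ)) (ℤ.pos-* j B))

  aB : + a * + B ≡ + (a ℕ.* B)
  aB = sym (ℤ.pos-* a B)

  rep-residue : ∀ {j} → j ℕ.< a → Residue a (+ B) r (+ (ρ ℕ.+ j ℕ.* B)) (q - + j)
  rep-residue {j} j<a = (ℤ.+≤+ ℕ.z≤n , subst (+ (ρ ℕ.+ j ℕ.* B) ℤ.<_) (sym aB) (ℤ.+<+ below)) , identity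
    where
    below : ρ ℕ.+ j ℕ.* B ℕ.< a ℕ.* B
    below = ℕ.≤-trans (ℕ.+-monoˡ-< (j ℕ.* B) (n%ℕd<d r B)) (ℕ.*-monoˡ-≤ B j<a)
    ring : ∀ ρ q j B → ρ + q * B ≡ (q - j) * B + (ρ + j * B)
    ring = solve-∀
    identity : r ≡ (q - + j) * + B + + (ρ ℕ.+ j ℕ.* B)
    identity = trans r≡ (trans (ring (+ ρ) q (+ j) (+ B)) (cong (_+_ ((q - + j) * + B)) (sym (rep-split j))))

  offset : ∀ {x y} → r ≡ y * + B + x → x ≡ + ρ + (q - y) * + B
  offset {x} {y} = residue-offset r (+ ρ) q y (+ B) x r≡

  -- Every residue is some rep j: its quotient against ρ is a j with 0 ≤ j < a.
  residue-rep : ∀ {x y} → Residue a (+ B) r x y → Σ ℕ λ j → j ℕ.< a × rep j ≡ (x , y)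
  residue-rep { -[1+ _ ]} ((() , _) , _)
  residue-rep {+ m} {y} ((_ , m<aB) , r≡y) with quotient-nonneg (q - y) (offset r≡y) (n%ℕd<d r B)
  ... | j , q-y≡j = j , j<a , cong₂ _,_ (cong +_ (sym m≡ρ+jB)) q-j≡y
    where
    m≡ρ+jB : m ≡ ρ ℕ.+ j ℕ.* B
    m≡ρ+jB = ℤ.+-injective (trans (offset r≡y)
               (trans (cong (λ J → + ρ + J * + B) q-y≡j) (sym (rep-split j))))
    j<a : j ℕ.< a
    j<a = ℕ.*-cancelʳ-< B j a (ℕ.≤-<-trans (ℕ.m≤n+m _ ρ)
            (subst (ℕ._< a ℕ.* B) m≡ρ+jB (ℤ.drop‿+<+ (subst (+ m ℤ.<_) aB m<aB))))
    cancel : ∀ q y → q - (q - y) ≡ y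
    cancel = solve-∀
    q-j≡y : q - + j ≡ y
    q-j≡y = trans (cong (q -_) (sym q-y≡j)) (cancel q y)

  residues : Counting (Residue a (+ B) r) a
  residues = record
    { list       = map rep (upTo a)
    ; enumerates = record
      { distinct = AllPairs.map⁺ (AllPairs.map (λ {i} {j} i≢j rep≡ → i≢j
                     (ℕ.*-cancelʳ-≡ i j B (ℕ.+-cancelˡ-≡ ρ _ _ (ℤ.+-injective rep≡)))) (upTo⁺ a))
      ; sound    = λ xy∈ → sound' (∈-map⁻ rep xy∈)
      ; complete = λ res → complete' (residue-rep res)
      }
    ; size       = trans (length-map rep (upTo a)) (length-upTo a)
    }
    where
    sound' : ∀ {x y} → Σ ℕ (λ j → j ∈ upTo a × (x , y) ≡ rep j) → Residue a (+ B) r x y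
    sound' (j , j∈ , refl) = rep-residue (∈-upTo⁻ j∈)
    complete' : ∀ {x y} → Σ ℕ (λ j → j ℕ.< a × rep j ≡ (x , y)) → (x , y) ∈ map rep (upTo a)
    complete' (j , j<a , refl) = ∈-map⁺ rep (∈-upTo⁺ j<a)

-- Counts of pairs of vectors can be built one coordinate at a time.
module Prepend {m : ℕ} {R : Vec ℤ (suc m) → Vec ℤ (suc m) → Set}
  {R' : Vec ℤ m → Vec ℤ m → Set} {S : Vec ℤ m → ℤ → ℤ → Set}
  (split : ∀ x β' y c' → R (x ∷ β') (y ∷ c') ⇔ (R' β' c' × S c' x y))
  {a : ℕ} (H : ∀ c' → Counting (S c') a) where

  prepend : Vec ℤ m × Vec ℤ m → ℤ × ℤ → Vec ℤ (suc m) × Vec ℤ (suc m)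
  prepend (β' , c') (x , y) = x ∷ β' , y ∷ c'

  layer : Vec ℤ m × Vec ℤ m → List (Vec ℤ (suc m) × Vec ℤ (suc m))
  layer p = map (prepend p) (list (H (proj₂ p)))

  -- Within a layer the new first coordinates differ; across layers the tails do.
  layer-distinct : ∀ p → AllPairs KeysDiffer (layer p)
  layer-distinct p = AllPairs.map⁺ (AllPairs.map (λ x≢x' eq → x≢x' (∷-injectiveˡ eq))
                                                  (distinct (enumerates (H (proj₂ p)))))

  layers-distinct : ∀ {p q} → KeysDiffer p q → All.All (λ z → All.All (KeysDiffer z) (layer q)) (layer p)
  layers-distinct {p} {q} β'≢ = All.tabulate λ z∈ → All.tabulate λ w∈ → apart (∈-map⁻ _ z∈) (∈-map⁻ _ w∈)
    where
    apart : ∀ {z w} → Σ _ (λ h → h ∈ list (H (proj₂ p)) × z ≡ prepend p h) →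
            Σ _ (λ h → h ∈ list (H (proj₂ q)) × w ≡ prepend q h) → KeysDiffer z w
    apart (_ , _ , refl) (_ , _ , refl) eq = β'≢ (∷-injectiveʳ eq)

  enumerate : ∀ {P'} → Enumerates R' P' → Enumerates R (concatMap layer P')
  enumerate {P'} E' = record
    { distinct = AllPairs.concat⁺ (All.map⁺ (All.universal layer-distinct P'))
                                  (AllPairs.map⁺ (AllPairs.map layers-distinct (distinct E')))
    ; sound    = sound'
    ; complete = complete'
    }
    where
    sound' : ∀ {β c} → (β , c) ∈ concatMap layer P' → R β c
    sound' z∈ with find (∈-concatMap⁻ layer {xs = P'} z∈)
    ... | p , p∈ , z∈layer with ∈-map⁻ (prepend p) z∈layer
    ...   | h , h∈ , refl = Equivalence.from (split _ _ _ _) (sound E' p∈ , sound (enumerates (H _)) h∈)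

    complete' : ∀ {β c} → R β c → (β , c) ∈ concatMap layer P'
    complete' {x ∷ β'} {y ∷ c'} Rβc with Equivalence.to (split x β' y c') Rβc
    ... | R'β'c' , Sxy = ∈-concatMap⁺ layer {xs = P'}
            (lose (complete E' R'β'c') (∈-map⁺ (prepend _) (complete (enumerates (H c')) Sxy)))

  length-concatMap : ∀ P' → length (concatMap layer P') ≡ a ℕ.* length P'
  length-concatMap []       = sym (ℕ.*-zeroʳ a)
  length-concatMap (p ∷ P') = begin
    length (layer p ++ concatMap layer P')           ≡⟨ length-++ (layer p) ⟩
    length (layer p) ℕ.+ length (concatMap layer P') ≡⟨ cong₂ ℕ._+_ layer-size (length-concatMap P') ⟩
    a ℕ.+ a ℕ.* length P'                            ≡⟨ sym (ℕ.*-suc a (length P')) ⟩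
    a ℕ.* suc (length P')                            ∎
    where
    open ≡-Reasoning
    layer-size : length (layer p) ≡ a
    layer-size = trans (length-map _ (list (H (proj₂ p)))) (size (H (proj₂ p)))

  prependAll : ∀ {N} → Counting R' N → Counting R (a ℕ.* N)
  prependAll C' = record
    { list       = concatMap layer (list C')
    ; enumerates = enumerate (enumerates C')
    ; size       = trans (length-concatMap (list C')) (cong (a ℕ.*_) (size C'))
    }

Box : ∀ {m} → ℕ → Matrix m → (Fin m → ℤ) → Set
Box a Q β = ∀ i → 0ℤ ℤ.≤ β i × β i ℤ.< + a * Q i i

-- T = Q·c + β, i.e. β ≡ T modulo the column lattice of Q.
Congruent : ∀ {m} → Matrix m → (Fin m → ℤ) → (Fin m → ℤ) → (Fin m → ℤ) → Set
Congruent Q T β c = ∀ i → T i ≡ combo Q c i + β i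

LatticePoint : ∀ {m} → ℕ → Matrix m → (Fin m → ℤ) → Vec ℤ m → Vec ℤ m → Set
LatticePoint a Q T β c = Box a Q (lookup β) × Congruent Q T (lookup β) (lookup c)

isolate : ∀ t s u x → (t ≡ (u + s) + x) ⇔ (t - s ≡ u + x)
isolate t s u x = mk⇔ (λ e → trans (cong (_- s) e) (ring₁ u s x))
                      (λ e → trans (ring₂ t s) (trans (cong (_+ s) e) (ring₃ u s x)))
  where
  ring₁ : ∀ u s x → (u + s) + x - s ≡ u + x
  ring₁ = solve-∀
  ring₂ : ∀ t s → t ≡ (t - s) + s
  ring₂ = solve-∀
  ring₃ : ∀ u s x → (u + x) + s ≡ (u + s) + x
  ring₃ = solve-∀

-- For upper triangular Q of size m+1, a lattice point (β , c) splits into a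
-- lattice point for the lower right block Q' and a residue condition on the
-- first coordinates: q₀₀ y + (Σₖ c'ₖ q₀,ₖ₊₁) + x = T₀ with 0 ≤ x < a·q₀₀.
module FirstRow {m} (a : ℕ) (Q : Matrix (suc m)) (ut : UpperTriangular Q) (T : Fin (suc m) → ℤ) where
  Q' : Matrix m
  Q' i k = Q (suc i) (suc k)

  Q'-triangular : UpperTriangular Q'
  Q'-triangular i k k<i = ut (suc i) (suc k) (ℕ.s≤s k<i)

  tailSum : Vec ℤ m → ℤ
  tailSum c' = sumFin (λ k → lookup c' k * Q zero (suc k))

  FirstCoordinates : Vec ℤ m → ℤ → ℤ → Set
  FirstCoordinates c' = Residue a (Q zero zero) (T zero - tailSum c')

  -- Below the first row the first column of Q vanishes.
  lowerRow : ∀ y c' i → combo Q (lookup (y ∷ c')) (suc i) ≡ combo Q' (lookup c') i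
  lowerRow y c' i = trans (cong (λ t → y * t + combo Q' (lookup c') i) (ut (suc i) zero ℕ.z<s))
                          (trans (cong (_+ combo Q' (lookup c') i) (ℤ.*-zeroʳ y)) (ℤ.+-identityˡ _))

  split : ∀ x β' y c' → LatticePoint a Q T (x ∷ β') (y ∷ c') ⇔
          (LatticePoint a Q' (T ∘ suc) β' c' × FirstCoordinates c' x y)
  split x β' y c' = mk⇔
    (λ (box , T≡) → (box ∘ suc , λ i → trans (T≡ (suc i)) (cong (_+ lookup β' i) (lowerRow y c' i))) ,
                    box zero , Equivalence.to row₀ (T≡ zero))
    (λ ((box' , T≡') , range , row) → (λ { zero → range ; (suc i) → box' i }) ,
       λ { zero    → Equivalence.from row₀ row
         ; (suc i) → trans (T≡' i) (cong (_+ lookup β' i) (sym (lowerRow y c' i))) })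
    where
    row₀ : (T zero ≡ (y * Q zero zero + tailSum c') + x) ⇔ (T zero - tailSum c' ≡ y * Q zero zero + x)
    row₀ = isolate (T zero) (tailSum c') (y * Q zero zero) x

-- For upper triangular Q with positive diagonal, every translate of the column
-- lattice of Q meets the box ∏ [0, a·qᵢᵢ) in exactly aᵐ points: by induction on
-- m, the first coordinate is determined modulo q₀₀ by the others.
count : ∀ m (a : ℕ) (Q : Matrix m) → UpperTriangular Q → (∀ i → 0ℤ ℤ.< Q i i) → (T : Fin m → ℤ) →
        Counting (LatticePoint a Q T) (a ℕ.^ m)
count zero    a Q ut pos T = record
  { list       = ([] , []) ∷ []
  ; enumerates = record
    { distinct = All.[] AllPairs.∷ AllPairs.[]
    ; sound    = λ { (here refl) → (λ ()) , (λ ()) }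
    ; complete = λ { {[]} {[]} _ → here refl }
    }
  ; size       = refl
  }
count (suc m) a Q ut pos T =
  Prepend.prependAll split firstCoordinates (count m a Q' Q'-triangular (pos ∘ suc) (T ∘ suc))
  where
  open FirstRow a Q ut T
  firstCoordinates : ∀ c' → Counting (FirstCoordinates c') a
  firstCoordinates c' with Q zero zero | pos zero
  ... | + suc b | _ = Residues.residues a b (T zero - tailSum c')
  ... | + zero  | ℤ.+<+ ()

inner-inject₁ : ∀ {d} (i : Fin d) → inner (inject₁ i) ≡ just i
inner-inject₁ {suc d} zero    = refl
inner-inject₁ {suc d} (suc i) rewrite inner-inject₁ i = refl

inner-fromℕ : ∀ d → inner (fromℕ d) ≡ nothing
inner-fromℕ zero    = refl
inner-fromℕ (suc d) rewrite inner-fromℕ d = refl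

snoc : ∀ {d} → (Fin d → ℤ) → ℤ → Fin (suc d) → ℤ
snoc c v x = maybe c v (inner x)

snoc-inject₁ : ∀ {d} (c : Fin d → ℤ) v i → snoc c v (inject₁ i) ≡ c i
snoc-inject₁ c v i rewrite inner-inject₁ i = refl

snoc-fromℕ : ∀ {d} (c : Fin d → ℤ) v → snoc c v (fromℕ d) ≡ v
snoc-fromℕ {d} c v rewrite inner-fromℕ d = refl

inject₁<fromℕ : ∀ {d} (i : Fin d) → toℕ (inject₁ i) ℕ.< toℕ (fromℕ d)
inject₁<fromℕ {d} i = subst₂ ℕ._<_ (sym (Fin.toℕ-inject₁ i)) (sym (Fin.toℕ-fromℕ d)) (Fin.toℕ<n i)

<⇒≤pred : ∀ {x y} → x ℤ.< y → x ℤ.≤ y - 1ℤ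
<⇒≤pred {x} {y} x<y = subst (x ℤ.≤_) (ℤ.+-comm ℤ.-1ℤ y) (ℤ.i<j⇒i≤pred[j] x<y)

≤pred⇒< : ∀ {x y} → x ℤ.≤ y - 1ℤ → x ℤ.< y
≤pred⇒< {x} {y} x≤ = ℤ.i≤pred[j]⇒i<j (subst (x ℤ.≤_) (ℤ.+-comm y ℤ.-1ℤ) x≤)

module Bordered {d} (A : Matrix d) (β : Fin d → ℤ) where

  Ã : Matrix (suc d)
  Ã = extend A β

  entry-inner : ∀ i k → Ã (inject₁ i) (inject₁ k) ≡ A i k
  entry-inner i k rewrite inner-inject₁ i | inner-inject₁ k = refl

  entry-border : ∀ i → Ã (inject₁ i) (fromℕ d) ≡ β i
  entry-border i rewrite inner-inject₁ i | inner-fromℕ d = refl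

  entry-bottom : ∀ k → Ã (fromℕ d) (inject₁ k) ≡ 0ℤ
  entry-bottom k rewrite inner-inject₁ k | inner-fromℕ d = refl

  entry-corner : Ã (fromℕ d) (fromℕ d) ≡ 1ℤ
  entry-corner rewrite inner-fromℕ d = refl

  combo-inner : ∀ c y → combo Ã c (inject₁ y) ≡ combo A (c ∘ inject₁) y + c (fromℕ d) * β y
  combo-inner c y = trans (sumFin-last (λ k → c k * Ã (inject₁ y) k))
    (cong₂ _+_ (sumFin-cong (λ k → cong (c (inject₁ k) *_) (entry-inner y k))) (cong (c (fromℕ d) *_) (entry-border y)))

  combo-bottom : ∀ c → combo Ã c (fromℕ d) ≡ c (fromℕ d)
  combo-bottom c = begin
    combo Ã c (fromℕ d)                               ≡⟨ sumFin-last (λ k → c k * Ã (fromℕ d) k) ⟩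
    sumFin old + c (fromℕ d) * Ã (fromℕ d) (fromℕ d) ≡⟨ cong₂ _+_ old≡0 (cong (c (fromℕ d) *_) entry-corner) ⟩
    0ℤ + c (fromℕ d) * 1ℤ                             ≡⟨ trans (ℤ.+-identityˡ _) (ℤ.*-identityʳ (c (fromℕ d))) ⟩
    c (fromℕ d)                                       ∎
    where
    open ≡-Reasoning
    old : Fin d → ℤ
    old k = c (inject₁ k) * Ã (fromℕ d) (inject₁ k)
    old≡0 : sumFin old ≡ 0ℤ
    old≡0 = sumFin-zero old (λ k → trans (cong (c (inject₁ k) *_) (entry-bottom k)) (ℤ.*-zeroʳ (c (inject₁ k))))

  combo-snoc : ∀ c v y → combo Ã (snoc c v) (inject₁ y) ≡ combo A c y + v * β y
  combo-snoc c v y = trans (combo-inner (snoc c v) y)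
    (cong₂ (λ s t → s + t * β y) (sumFin-cong (λ k → cong (_* A y k) (snoc-inject₁ c v k))) (snoc-fromℕ c v))

  triangular : UpperTriangular A → UpperTriangular Ã
  triangular ut x k k<x with view x | view k
  ... | ‵inject₁ i | ‵inject₁ k' =
    trans (entry-inner i k') (ut i k' (subst₂ ℕ._<_ (Fin.toℕ-inject₁ k') (Fin.toℕ-inject₁ i) k<x))
  ... | ‵inject₁ i | ‵fromℕ      = ⊥-elim (ℕ.<-asym (inject₁<fromℕ i) k<x)
  ... | ‵fromℕ     | ‵inject₁ k' = entry-bottom k'
  ... | ‵fromℕ     | ‵fromℕ      = ⊥-elim (ℕ.<-irrefl refl k<x)

  -- The last row forces the last coefficient to vanish; the rest is A's rank.
  fullRank : FullRank A → FullRank Ã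
  fullRank fr c̃ c̃↦0 = vanishes
    where
    last≡0 : c̃ (fromℕ d) ≡ 0ℤ
    last≡0 = trans (sym (combo-bottom c̃)) (c̃↦0 (fromℕ d))
    inner↦0 : ∀ y → combo A (c̃ ∘ inject₁) y ≡ 0ℤ
    inner↦0 y = trans (sym (trans (cong (λ t → combo A (c̃ ∘ inject₁) y + t * β y) last≡0) (ℤ.+-identityʳ _)))
                      (trans (sym (combo-inner c̃ y)) (c̃↦0 (inject₁ y)))
    vanishes : ∀ k → c̃ k ≡ 0ℤ
    vanishes k with view k
    ... | ‵fromℕ      = last≡0
    ... | ‵inject₁ k' = fr (c̃ ∘ inject₁) inner↦0 k'

  InBox : Set
  InBox = ∀ i → 0ℤ ℤ.≤ β i × β i ℤ.< A i i

  -- Ã is reduced iff A is and β is in the box (the new row 0 ⋯ 0 1 always is).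
  reduced : IsReduced A → IsReduced Ã ⇔ InBox
  reduced (pos , off) = mk⇔ to from
    where
    Reduced : ℤ → ℤ → Set
    Reduced u v = (0ℤ ℤ.≤ u) × (u ℤ.≤ v - 1ℤ)

    to : IsReduced Ã → InBox
    to (_ , offÃ) i with offÃ (inject₁ i) (fromℕ d) (inject₁<fromℕ i)
    ... | 0≤ , ≤a-1 = subst (0ℤ ℤ.≤_) (entry-border i) 0≤ ,
                      ≤pred⇒< (subst₂ (λ u v → u ℤ.≤ v - 1ℤ) (entry-border i) (entry-inner i i) ≤a-1)

    from : InBox → IsReduced Ã
    from box = posÃ , offÃ
      where
      posÃ : ∀ x → 0ℤ ℤ.< Ã x x
      posÃ x with view x
      ... | ‵inject₁ i = subst (0ℤ ℤ.<_) (sym (entry-inner i i)) (pos i)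
      ... | ‵fromℕ     = subst (0ℤ ℤ.<_) (sym entry-corner) (ℤ.+<+ ℕ.z<s)
      offÃ : ∀ x k → toℕ x ℕ.< toℕ k → (0ℤ ℤ.≤ Ã x k) × (Ã x k ℤ.≤ Ã x x - 1ℤ)
      offÃ x k x<k with view x | view k
      ... | ‵inject₁ i | ‵inject₁ k' = subst₂ Reduced (sym (entry-inner i k')) (sym (entry-inner i i))
                                         (off i k' (subst₂ ℕ._<_ (Fin.toℕ-inject₁ i) (Fin.toℕ-inject₁ k') x<k))
      ... | ‵inject₁ i | ‵fromℕ      = subst₂ Reduced (sym (entry-border i)) (sym (entry-inner i i))
                                         (proj₁ (box i) , <⇒≤pred (proj₂ (box i)))
      ... | ‵fromℕ     | _           = ⊥-elim (ℕ.<⇒≱ x<k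
                                         (subst (toℕ k ℕ.≤_) (sym (Fin.toℕ-fromℕ d)) (Fin.toℕ≤pred[n] k)))

-- Its columns 0,…,d-1 are those of A with a zero
-- appended, so all shift conditions but the one for column d-1 are inherited
-- from A; that one says precisely: s = A·c + a·β, where s is the last column
-- of A shifted down and a is its last diagonal entry.
module BorderedShift {n} (A : Matrix (suc n)) (β : Fin (suc n) → ℤ) where
  open Bordered A β

  a : ℤ
  a = A (fromℕ n) (fromℕ n)

  BorderCondition : (Fin (suc n) → ℤ) → Set
  BorderCondition c = ∀ i → shiftDown (col A (fromℕ n)) i ≡ combo A c i + a * β i

  -- The condition only depends on c through the combination A·c.
  border-tabulate : ∀ c → BorderCondition c → BorderCondition (lookup (tabulate c))
  border-tabulate c border i =
    trans (border i) (cong (_+ a * β i) (sumFin-cong (λ l → cong (_* A i l) (sym (lookup∘tabulate c l)))))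

  shift-inner : ∀ j y → shiftDown (col Ã (inject₁ j)) (inject₁ y) ≡ shiftDown (col A j) y
  shift-inner j zero    = refl
  shift-inner j (suc y) = entry-inner (inject₁ y) j

  shift-bottom : ∀ j → shiftDown (col Ã (inject₁ j)) (fromℕ (suc n)) ≡ A (fromℕ n) j
  shift-bottom j = entry-inner (fromℕ n) j

  toℕ-columnₙ : toℕ (inject₁ (fromℕ n)) ≡ n
  toℕ-columnₙ = trans (Fin.toℕ-inject₁ (fromℕ n)) (Fin.toℕ-fromℕ n)

  -- Reading off the shift condition of column d-1 of Ã: its last row forces
  -- the last coefficient to be a, the other rows give the border condition.
  shiftClosed⇒border : ShiftClosed Ã → Σ (Fin (suc n) → ℤ) BorderCondition
  shiftClosed⇒border closed = c̃ ∘ inject₁ , condition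
    where
    span : InSpanUpTo Ã (suc (toℕ (inject₁ (fromℕ n)))) (shiftDown (col Ã (inject₁ (fromℕ n))))
    span = closed (inject₁ (fromℕ n)) (ℕ.s≤s (ℕ.s≤s (ℕ.≤-reflexive toℕ-columnₙ)))
    c̃ : Fin (suc (suc n)) → ℤ
    c̃ = proj₁ span
    eq : ∀ x → shiftDown (col Ã (inject₁ (fromℕ n))) x ≡ combo Ã c̃ x
    eq = proj₂ (proj₂ span)
    last≡a : c̃ (fromℕ (suc n)) ≡ a
    last≡a = trans (sym (combo-bottom c̃)) (trans (sym (eq (fromℕ (suc n)))) (shift-bottom (fromℕ n)))
    condition : BorderCondition (c̃ ∘ inject₁)
    condition y = begin
      shiftDown (col A (fromℕ n)) y                      ≡⟨ sym (shift-inner (fromℕ n) y) ⟩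
      shiftDown (col Ã (inject₁ (fromℕ n))) (inject₁ y) ≡⟨ eq (inject₁ y) ⟩
      combo Ã c̃ (inject₁ y)                              ≡⟨ combo-inner c̃ y ⟩
      combo A (c̃ ∘ inject₁) y + c̃ (fromℕ (suc n)) * β y ≡⟨ cong (λ t → combo A (c̃ ∘ inject₁) y + t * β y) last≡a ⟩
      combo A (c̃ ∘ inject₁) y + a * β y                  ∎
      where open ≡-Reasoning

  -- Column d-1 of Ã: a solution of the border condition, with last coefficient a.
  lastColumn : Σ (Fin (suc n) → ℤ) BorderCondition →
               InSpanUpTo Ã (suc (toℕ (inject₁ (fromℕ n)))) (shiftDown (col Ã (inject₁ (fromℕ n))))
  lastColumn (c , border) = snoc c a , none-above , eq
    where
    none-above : ∀ k → suc (toℕ (inject₁ (fromℕ n))) ℕ.< toℕ k → snoc c a k ≡ 0ℤ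
    none-above k k> =
      ⊥-elim (ℕ.<⇒≱ k> (subst (λ t → toℕ k ℕ.≤ suc t) (sym toℕ-columnₙ) (Fin.toℕ≤pred[n] k)))
    eq : ∀ x → shiftDown (col Ã (inject₁ (fromℕ n))) x ≡ combo Ã (snoc c a) x
    eq x with view x
    ... | ‵inject₁ y = trans (shift-inner (fromℕ n) y) (trans (border y) (sym (combo-snoc c a y)))
    ... | ‵fromℕ     = trans (shift-bottom (fromℕ n)) (sym (trans (combo-bottom (snoc c a)) (snoc-fromℕ c a)))

  -- Column j < d-1 of Ã: the shift condition of column j of A, with last
  -- coefficient 0 (the new last row of the shifted column is a_{d-1,j} = 0).
  earlierColumn : UpperTriangular A → ShiftClosed A → ∀ (j : Fin n) →
                  InSpanUpTo Ã (suc (toℕ (inject₁ (inject₁ j)))) (shiftDown (col Ã (inject₁ (inject₁ j))))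
  earlierColumn ut closed j = snoc c 0ℤ , none-above , eq
    where
    span : InSpanUpTo A (suc (toℕ (inject₁ j))) (shiftDown (col A (inject₁ j)))
    span = closed (inject₁ j) (ℕ.s≤s (subst (ℕ._< n) (sym (Fin.toℕ-inject₁ j)) (Fin.toℕ<n j)))
    c : Fin (suc n) → ℤ
    c = proj₁ span
    none-above : ∀ k → suc (toℕ (inject₁ (inject₁ j))) ℕ.< toℕ k → snoc c 0ℤ k ≡ 0ℤ
    none-above k k> with view k
    ... | ‵inject₁ k' = trans (snoc-inject₁ c 0ℤ k') (proj₁ (proj₂ span) k'
                          (subst₂ (λ u v → suc u ℕ.< v) (Fin.toℕ-inject₁ (inject₁ j)) (Fin.toℕ-inject₁ k') k>))
    ... | ‵fromℕ      = snoc-fromℕ c 0ℤ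
    eq : ∀ x → shiftDown (col Ã (inject₁ (inject₁ j))) x ≡ combo Ã (snoc c 0ℤ) x
    eq x with view x
    ... | ‵inject₁ y = trans (shift-inner (inject₁ j) y) (trans (proj₂ (proj₂ span) y)
                         (sym (trans (combo-snoc c 0ℤ y) (ℤ.+-identityʳ (combo A c y)))))
    ... | ‵fromℕ     = trans (shift-bottom (inject₁ j)) (trans (ut (fromℕ n) (inject₁ j) (inject₁<fromℕ j))
                         (sym (trans (combo-bottom (snoc c 0ℤ)) (snoc-fromℕ c 0ℤ))))

  border⇒shiftClosed : UpperTriangular A → ShiftClosed A → Σ (Fin (suc n) → ℤ) BorderCondition → ShiftClosed Ã
  border⇒shiftClosed ut closed border j j-bound with view j
  ... | ‵fromℕ = ⊥-elim (ℕ.<-irrefl refl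
                   (ℕ.≤-trans (ℕ.s≤s (ℕ.s≤s (ℕ.≤-reflexive (sym (Fin.toℕ-fromℕ n))))) (ℕ.≤-pred j-bound)))
  ... | ‵inject₁ j' with view j'
  ...   | ‵fromℕ       = lastColumn border
  ...   | ‵inject₁ j'' = earlierColumn ut closed j''

characterisation : ∀ {n} (A : Matrix (suc n)) (β : Fin (suc n) → ℤ) → IsReducedIdealizing A →
  IsReducedIdealizing (extend A β) ⇔ (Bordered.InBox A β × Σ (Fin (suc n) → ℤ) (BorderedShift.BorderCondition A β))
characterisation A β ((ut , fr , closed) , red) = mk⇔
  (λ ((_ , _ , closedÃ) , redÃ) → Equivalence.to (reduced red) redÃ , shiftClosed⇒border closedÃ)
  (λ (box , border) → (triangular ut , fullRank fr , border⇒shiftClosed ut closed border) ,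
                      Equivalence.from (reduced red) box)
  where
  open Bordered A β
  open BorderedShift A β


combo-scale : ∀ {m} (A Q : Matrix m) k → (∀ i l → A i l ≡ k * Q i l) → ∀ c i → combo A c i ≡ k * combo Q c i
combo-scale A Q k A≡kQ c i =
  trans (sumFin-cong (λ l → trans (cong (c l *_) (A≡kQ i l)) (ring (c l) k (Q i l)))) (sumFin-scale k (λ l → c l * Q i l))
  where
  ring : ∀ x k q → x * (k * q) ≡ k * (x * q)
  ring = solve-∀

positive-suc : ∀ {x} → 0ℤ ℤ.< x → Σ ℕ λ b → x ≡ + suc b
positive-suc {+ suc b}   _          = b , refl
positive-suc {+ zero}    (ℤ.+<+ ())
positive-suc { -[1+ _ ]} ()

pos-^ : ∀ m k → + (m ℕ.^ k) ≡ (+ m) ^ k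
pos-^ m zero    = refl
pos-^ m (suc k) = trans (ℤ.pos-* m (m ℕ.^ k)) (cong (+ m *_) (pos-^ m k))

-- Dividing A by its last diagonal entry a = k turns the bordering conditions
-- into the lattice count for Q = A / a and T = s / a.
module LastDiagonalQuotient {n} (A : Matrix (suc n)) (ut : UpperTriangular A) (closed : ShiftClosed A)
  (pos : ∀ i → 0ℤ ℤ.< A i i) where
  open DiagonalDivisibility A ut (λ i Aii≡0 → ℤ.<-irrefl (sym Aii≡0) (pos i)) closed

  b : ℕ
  b = proj₁ (positive-suc (pos (fromℕ n)))

  k : ℤ
  k = + suc b

  a≡k : A (fromℕ n) (fromℕ n) ≡ k
  a≡k = proj₂ (positive-suc (pos (fromℕ n)))

  Q : Matrix (suc n)
  Q i l = quotient (lastDiagonal∣ i l)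

  A≡kQ : ∀ i l → A i l ≡ k * Q i l
  A≡kQ i l = trans (_∣_.equality (lastDiagonal∣ i l)) (trans (cong (Q i l *_) a≡k) (ℤ.*-comm (Q i l) k))

  Q-triangular : UpperTriangular Q
  Q-triangular i l l<i = ℤ.*-cancelˡ-≡ k (Q i l) 0ℤ (trans (sym (A≡kQ i l)) (trans (ut i l l<i) (sym (ℤ.*-zeroʳ k))))

  Q-positive : ∀ i → 0ℤ ℤ.< Q i i
  Q-positive i = ℤ.*-cancelˡ-<-nonNeg k (subst₂ ℤ._<_ (sym (ℤ.*-zeroʳ k)) (A≡kQ i i) (pos i))

  T : Fin (suc n) → ℤ
  T = shiftDown (col Q (fromℕ n))

  s≡kT : ∀ i → shiftDown (col A (fromℕ n)) i ≡ k * T i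
  s≡kT zero    = sym (ℤ.*-zeroʳ k)
  s≡kT (suc i) = A≡kQ (inject₁ i) (fromℕ n)

  Admissible : Vec ℤ (suc n) → Vec ℤ (suc n) → Set
  Admissible β c = Bordered.InBox A (lookup β) × BorderedShift.BorderCondition A (lookup β) (lookup c)

  -- The bordering conditions on (β , c) are those of a lattice point for Q:
  -- the border condition is k times the congruence T = Q·c + β.
  lattice⇔admissible : ∀ β c → LatticePoint (suc b) Q T β c ⇔ Admissible β c
  lattice⇔admissible β c = mk⇔
    (λ (box , T≡) → (λ i → proj₁ (box i) , subst (_ ℤ.<_) (sym (A≡kQ i i)) (proj₂ (box i))) ,
                    λ i → trans (s≡kT i) (trans (cong (k *_) (T≡ i)) (sym (scaled i))))
    (λ (box , border) → (λ i → proj₁ (box i) , subst (_ ℤ.<_) (A≡kQ i i) (proj₂ (box i))) ,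
                        λ i → ℤ.*-cancelˡ-≡ k _ _ (trans (sym (s≡kT i)) (trans (border i) (scaled i))))
    where
    scaled : ∀ i → combo A (lookup c) i + A (fromℕ n) (fromℕ n) * lookup β i ≡ k * (combo Q (lookup c) i + lookup β i)
    scaled i = trans (cong₂ _+_ (combo-scale A Q k A≡kQ (lookup c) i) (cong (_* lookup β i) a≡k))
                     (sym (ℤ.*-distribˡ-+ k (combo Q (lookup c) i) (lookup β i)))

  admissible : Counting Admissible (suc b ℕ.^ suc n)
  admissible = counting-⇔ lattice⇔admissible (count (suc n) (suc b) Q Q-triangular Q-positive T)

  size≡aᵈ : + (suc b ℕ.^ suc n) ≡ A (fromℕ n) (fromℕ n) ^ suc n
  size≡aᵈ = trans (pos-^ (suc b) (suc n)) (cong (_^ suc n) (sym a≡k))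

lemma3p1 : (n : ℕ) (A : Matrix (suc n)) → IsReducedIdealizing A →
    Σ (List (Vec ℤ (suc n))) λ L →
      Unique L ×
      (∀ (β : Vec ℤ (suc n)) → (β ∈ L) ⇔ IsReducedIdealizing (extend A (lookup β))) ×
      (+ length L ≡ A (fromℕ n) (fromℕ n) ^ suc n)
lemma3p1 n A isRI@((ut , _ , closed) , pos , _) =
  map proj₁ P , keys-unique E , admissible⇔ , trans (cong +_ (trans (length-map proj₁ P) (size admissible))) size≡aᵈ
  where
  open LastDiagonalQuotient A ut closed pos
  P : List (Vec ℤ (suc n) × Vec ℤ (suc n))
  P = list admissible
  E : Enumerates Admissible P
  E = enumerates admissible

  admissible⇔ : ∀ β → (β ∈ map proj₁ P) ⇔ IsReducedIdealizing (extend A (lookup β))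
  admissible⇔ β = mk⇔
    (λ β∈ → let (c , box , border) = Equivalence.to (keys-∈ E β) β∈
            in Equivalence.from (characterisation A (lookup β) isRI) (box , lookup c , border))
    (λ isRIÃ → let (box , c , border) = Equivalence.to (characterisation A (lookup β) isRI) isRIÃ
               in Equivalence.from (keys-∈ E β) (tabulate c , box , BorderedShift.border-tabulate A (lookup β) c border))
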